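{- (1) $E^{\partial}_{FTP}$ is sound for bisimilarity on $T(\Sigma^{\partial}_{FTP})$, i.e. $E^{\partial}_{FTP}\vdash s=t$ implies $s\sim t$ for closed $s,t$. (2) For every $t\in T(\Sigma^{\partial}_{FTP})$ there exists $t'\in T(\Sigma_{FTP})$ such that $E^{\partial}_{FTP}\vdash t=t'$.
   Context: Fix a finite nonempty set of actions $\mathcal{A}$, a finite set of predicates $\mathcal{P}$, a subset $\mathcal{P}^I\subseteq\mathcal{P}$ and sets $\mathcal{A}_P\subseteq\mathcal{A}$ for $P\in\mathcal{P}^I$. $\Sigma_{FTP}$: constant $\delta$, constants $\kappa_P$ ($P\in\mathcal{P}$), prefixes $a.\_$ ($a\in\mathcal{A}$), binary $+$. $\Sigma^{\partial}_{FTP}$ extends it with unary operations $\partial_{\mathcal{B},\mathcal{Q}}$ for all $\mathcal{B}\subseteq\mathcal{A}$, $\mathcal{Q}\subseteq\mathcal{P}$. Semantics: least relations closed under $a.x\xrightarrow{a}x$; $x\xrightarrow{a}x'\Rightarrow x+y\xrightarrow{a}x'$; $y\xrightarrow{a}y'\Rightarrow x+y\xrightarrow{a}y'$; $P\kappa_P$; $Px\Rightarrow P(x+y)$; $Py\Rightarrow P(x+y)$; $Px\Rightarrow P(a.x)$ for $P\in\mathcal{P}^I,a\in\mathcal{A}_P$; $x\xrightarrow{a}x'\Rightarrow\partial_{\mathcal{B},\mathcal{Q}}(x)\xrightarrow{a}\partial_{\emptyset,\mathcal{Q}\cap\mathcal{P}^I}(x')$ if $a\notin\mathcal{B}$; $Px\Rightarrow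 P(\partial_{\mathcal{B},\mathcal{Q}}(x))$ if $P\notin\mathcal{Q}$. $E^{\partial}_{FTP}$ consists of: $x+y=y+x$; $(x+y)+z=x+(y+z)$; $x+x=x$; $x+\delta=x$; $a.(x+\kappa_P)=a.(x+\kappa_P)+\kappa_P$ ($P\in\mathcal{P}^I,a\in\mathcal{A}_P$); $\partial_{\mathcal{B},\mathcal{Q}}(\delta)=\delta$; $\partial_{\mathcal{B},\mathcal{Q}}(\kappa_P)=\delta$ if $P\in\mathcal{Q}$; $\partial_{\mathcal{B},\mathcal{Q}}(\kappa_P)=\kappa_P$ if $P\notin\mathcal{Q}$; for $a\in\mathcal{B}$ and every closed term $t$, $\partial_{\mathcal{B},\mathcal{Q}}(a.t)=\sum\{\kappa_P\mid P\notin\mathcal{Q},\ P(a.t)\text{ holds}\}$ (empty sum $=\delta$); $\partial_{\mathcal{B},\mathcal{Q}}(a.x)=\partial_{\emptyset,\mathcal{Q}}(a.x)$ if $a\notin\mathcal{B}$; $\partial_{\emptyset,\mathcal{Q}}(a.x)=a.\partial_{\emptyset,\mathcal{Q}\cap\mathcal{P}^I}(x)$; $\partial_{\mathcal{B},\mathcal{Q}}(x+y)=\partial_{\mathcal{B},\mathcal{Q}}(x)+\partial_{\mathcal{B},\mathcal{Q}}(y)$. $\vdash$ is equational-logic derivability. Bisimilarity $\sim$: largest symmetric relation such that related terms match each other's transitions (into related terms) and satisfy the same predicates. -}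

module Defs where

open import Data.Nat using (ℕ; suc)
open import Data.Fin using (Fin)
open import Data.Fin.Subset using (Subset; _∈_; _∉_; _∩_) renaming (⊥ to ∅)
open import Data.Empty renaming (⊥ to Empty)
open import Data.List using (List; []; _∷_)
open import Data.List.Membership.Propositional using () renaming (_∈_ to _∈ᴸ_)
open import Data.Product using (Σ; ∃; _×_; _,_)
open import Function.Bundles using (_⇔_)

-- The whole development is parameterised by:
--   nA     : actions are  Act = Fin (suc nA)   (a finite nonempty set)
--   nP     : predicates are Pred = Fin nP      (a finite set)
--   PI     : the subset P^I of Pred
--   AP     : AP P is the set A_P ⊆ Act (only consulted when P ∈ PI)
module FTP (nA nP : ℕ) (PI : Subset nP) (AP : Fin nP → Subset (suc nA)) where

  Act : Set
  Act = Fin (suc nA)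

  Pred : Set
  Pred = Fin nP

  infixr 20 _·_
  infixl 10 _⊕_

  data Term (V : Set) : Set where
    var : V → Term V
    δ   : Term V
    κ   : Pred → Term V
    _·_ : Act → Term V → Term V
    _⊕_ : Term V → Term V → Term V
    ∂   : Subset (suc nA) → Subset nP → Term V → Term V

  CTerm : Set
  CTerm = Term Empty

  embed : {V : Set} → CTerm → Term V
  embed (var ())
  embed δ = δ
  embed (κ P) = κ P
  embed (a · t) = a · embed t
  embed (t ⊕ u) = embed t ⊕ embed u
  embed (∂ B Q t) = ∂ B Q (embed t)

  data ∂Free {V : Set} : Term V → Set where
    var : (x : V) → ∂Free (var x)
    δ   : ∂Free δ
    κ   : (P : Pred) → ∂Free (κ P)
    _·_ : (a : Act) {t : Term V} → ∂Free t → ∂Free (a · t)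
    _⊕_ : {t u : Term V} → ∂Free t → ∂Free u → ∂Free (t ⊕ u)

  data Step : CTerm → Act → CTerm → Set where
    pre  : ∀ a x → Step (a · x) a x
    sumˡ : ∀ {x x' a} y → Step x a x' → Step (x ⊕ y) a x'
    sumʳ : ∀ {y y' a} x → Step y a y' → Step (x ⊕ y) a y'
    enc  : ∀ {x x' a} B Q → a ∉ B → Step x a x' →
           Step (∂ B Q x) a (∂ ∅ (Q ∩ PI) x')

  data Holds : Pred → CTerm → Set where
    kap  : ∀ P → Holds P (κ P)
    sumˡ : ∀ {P x} y → Holds P x → Holds P (x ⊕ y)
    sumʳ : ∀ {P y} x → Holds P y → Holds P (x ⊕ y)
    pre  : ∀ {P x} a → P ∈ PI → a ∈ AP P → Holds P x → Holds P (a · x)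
    enc  : ∀ {P x} B Q → P ∉ Q → Holds P x → Holds P (∂ B Q x)

  record IsBisimulation (R : CTerm → CTerm → Set) : Set where
    field
      symm  : ∀ {s t} → R s t → R t s
      transˡ : ∀ {s t a s'} → R s t → Step s a s' →
               ∃ λ t' → Step t a t' × R s' t'
      transʳ : ∀ {s t a t'} → R s t → Step t a t' →
               ∃ λ s' → Step s a s' × R s' t'
      preds : ∀ {s t} → R s t → (P : Pred) → Holds P s ⇔ Holds P t

  _∼_ : CTerm → CTerm → Set₁
  s ∼ t = Σ (CTerm → CTerm → Set) λ R → IsBisimulation R × R s t

  sumκ : {V : Set} → List Pred → Term V
  sumκ [] = δ
  sumκ (P ∷ []) = κ P
  sumκ (P ∷ L@(_ ∷ _)) = κ P ⊕ sumκ L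

  infix 4 E⊢_≈_
  data E⊢_≈_ {V : Set} : Term V → Term V → Set₁ where
    refl   : ∀ {t} → E⊢_≈_ t t
    sym    : ∀ {s t} → E⊢_≈_ s t → E⊢_≈_ t s
    trans  : ∀ {s t u} → E⊢_≈_ s t → E⊢_≈_ t u → E⊢_≈_ s u
    cong-· : ∀ a {s t} → E⊢_≈_ s t → E⊢_≈_ (a · s) (a · t)
    cong-⊕ : ∀ {s s' t t'} → E⊢_≈_ s s' → E⊢_≈_ t t' → E⊢_≈_ (s ⊕ t) (s' ⊕ t')
    cong-∂ : ∀ B Q {s t} → E⊢_≈_ s t → E⊢_≈_ (∂ B Q s) (∂ B Q t)
    A-comm  : ∀ x y → E⊢_≈_ (x ⊕ y) (y ⊕ x)
    A-assoc : ∀ x y z → E⊢_≈_ ((x ⊕ y) ⊕ z) (x ⊕ (y ⊕ z))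
    A-idem  : ∀ x → E⊢_≈_ (x ⊕ x) x
    A-δ     : ∀ x → E⊢_≈_ (x ⊕ δ) x
    A-pers  : ∀ P a x → P ∈ PI → a ∈ AP P →
              E⊢_≈_ (a · (x ⊕ κ P)) (a · (x ⊕ κ P) ⊕ κ P)
    D-δ     : ∀ B Q → E⊢_≈_ (∂ B Q δ) δ
    D-κ∈    : ∀ B Q P → P ∈ Q → E⊢_≈_ (∂ B Q (κ P)) δ
    D-κ∉    : ∀ B Q P → P ∉ Q → E⊢_≈_ (∂ B Q (κ P)) (κ P)
    D-blk   : ∀ B Q a (t : CTerm) (L : List Pred) → a ∈ B →
              (∀ P → (P ∈ᴸ L) ⇔ (P ∉ Q × Holds P (a · t))) →
              E⊢_≈_ (∂ B Q (a · embed t)) (sumκ L)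
    D-nblk  : ∀ B Q a x → a ∉ B → E⊢_≈_ (∂ B Q (a · x)) (∂ ∅ Q (a · x))
    D-pre   : ∀ Q a x → E⊢_≈_ (∂ ∅ Q (a · x)) (a · ∂ ∅ (Q ∩ PI) x)
    D-+     : ∀ B Q x y → E⊢_≈_ (∂ B Q (x ⊕ y)) (∂ B Q x ⊕ ∂ B Q y)

module Submission where

-- Equational derivability E⊢_≈_ lives in Set₁, while a
-- bisimulation must be a Set-valued relation, so on closed terms we use a
-- Set-valued copy _≃_: the equivalence and congruence closure of the
-- closed instances of the axioms (data Axiom).  Every axiom instance s = t
-- relates terms with *identical* behaviour: each step of one side is a step
-- of the other side to the very same residual, and both sides satisfy the
-- same predicates.  A one-sided transfer property (Simulates) is preserved
-- by the closure rules, so _≃_ is a bisimulation, and E⊢ s ≈ t ⇒ s ≃ t.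
--
-- Predicates are decidable, so for a blocked prefix the set
-- {P ∉ Q | P(a.t)} can be enumerated as a list and axiom D-blk applies.
-- By induction on ∂-free terms, ∂_{B,Q}(u) is provably equal to a ∂-free
-- term; by structural induction every closed term is.

open import Defs
open import Data.Nat using (ℕ; suc)
open import Data.Fin using (Fin)
open import Data.Fin.Subset using (Subset; _∈_; _∉_; _∩_) renaming (⊥ to ∅)
open import Data.Fin.Subset.Properties using (_∈?_; ∉⊥; x∈p∩q⁺; x∈p∩q⁻)
open import Data.Fin.Properties using (_≟_)
open import Data.Empty using (⊥-elim) renaming (⊥ to Empty)
open import Data.List using (List; []; _∷_; filter; allFin)
open import Data.List.Membership.Propositional using () renaming (_∈_ to _∈ᴸ_)
open import Data.List.Membership.Propositional.Properties using (∈-filter⁺; ∈-filter⁻; ∈-allFin)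
open import Data.List.Relation.Unary.Any using (here; there)
open import Data.Product using (_×_; ∃; _,_; proj₁; proj₂; swap)
open import Function using (id)
open import Function.Bundles using (_⇔_; mk⇔; Equivalence)
open import Relation.Nullary using (Dec; yes; no)
open import Relation.Nullary.Decidable using (¬?; _×-dec_)
open import Relation.Binary.PropositionalEquality as ≡ using (_≡_; subst)

enumerate : ∀ {n} (D : Fin n → Set) → (∀ i → Dec (D i)) →
            ∃ λ (L : List (Fin n)) → ∀ i → (i ∈ᴸ L) ⇔ D i
enumerate {n} D D? =
  filter D? (allFin n) ,
  λ i → mk⇔ (λ i∈L → proj₂ (∈-filter⁻ D? {xs = allFin n} i∈L)) (∈-filter⁺ D? (∈-allFin i))

module _ (nA nP : ℕ) (PI : Subset nP) (AP : Fin nP → Subset (suc nA)) where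
  open FTP nA nP PI AP

  embed-id : (t : CTerm) → embed t ≡ t
  embed-id (var ())
  embed-id δ = ≡.refl
  embed-id (κ P) = ≡.refl
  embed-id (a · t) = ≡.cong (a ·_) (embed-id t)
  embed-id (t ⊕ u) = ≡.cong₂ _⊕_ (embed-id t) (embed-id u)
  embed-id (∂ B Q t) = ≡.cong (∂ B Q) (embed-id t)

  sumκ-inert : ∀ (L : List Pred) {a t'} → Step (sumκ L) a t' → Empty
  sumκ-inert [] ()
  sumκ-inert (P ∷ []) ()
  sumκ-inert (P ∷ _ ∷ L) (sumˡ _ ())
  sumκ-inert (P ∷ R ∷ L) (sumʳ _ st) = sumκ-inert (R ∷ L) st

  ∈⇒sumκ-holds : ∀ {P} (L : List Pred) → P ∈ᴸ L → Holds P (sumκ L)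
  ∈⇒sumκ-holds (P ∷ []) (here ≡.refl) = kap P
  ∈⇒sumκ-holds (P ∷ _ ∷ L) (here ≡.refl) = sumˡ _ (kap P)
  ∈⇒sumκ-holds (P ∷ R ∷ L) (there P∈L) = sumʳ _ (∈⇒sumκ-holds (R ∷ L) P∈L)

  sumκ-holds⇒∈ : ∀ {P} (L : List Pred) → Holds P (sumκ L) → P ∈ᴸ L
  sumκ-holds⇒∈ [] ()
  sumκ-holds⇒∈ (P ∷ []) (kap _) = here ≡.refl
  sumκ-holds⇒∈ (P ∷ _ ∷ L) (sumˡ _ (kap _)) = here ≡.refl
  sumκ-holds⇒∈ (P ∷ R ∷ L) (sumʳ _ h) = there (sumκ-holds⇒∈ (R ∷ L) h)

  sumκ-∂Free : ∀ (L : List Pred) → ∂Free {Empty} (sumκ L)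
  sumκ-∂Free [] = δ
  sumκ-∂Free (P ∷ []) = κ P
  sumκ-∂Free (P ∷ R ∷ L) = κ P ⊕ sumκ-∂Free (R ∷ L)

  data Axiom : CTerm → CTerm → Set where
    comm       : ∀ x y → Axiom (x ⊕ y) (y ⊕ x)
    assoc      : ∀ x y z → Axiom ((x ⊕ y) ⊕ z) (x ⊕ (y ⊕ z))
    idem       : ∀ x → Axiom (x ⊕ x) x
    δ-unit     : ∀ x → Axiom (x ⊕ δ) x
    persist    : ∀ P a x → P ∈ PI → a ∈ AP P →
                 Axiom (a · (x ⊕ κ P)) (a · (x ⊕ κ P) ⊕ κ P)
    ∂-δ        : ∀ B Q → Axiom (∂ B Q δ) δ
    ∂-κ∈       : ∀ B Q P → P ∈ Q → Axiom (∂ B Q (κ P)) δ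
    ∂-κ∉       : ∀ B Q P → P ∉ Q → Axiom (∂ B Q (κ P)) (κ P)
    ∂-blocked  : ∀ B Q a t (L : List Pred) → a ∈ B →
                 (∀ P → (P ∈ᴸ L) ⇔ (P ∉ Q × Holds P (a · t))) →
                 Axiom (∂ B Q (a · t)) (sumκ L)
    ∂-enabled  : ∀ B Q a x → a ∉ B → Axiom (∂ B Q (a · x)) (∂ ∅ Q (a · x))
    ∂-prefix   : ∀ Q a x → Axiom (∂ ∅ Q (a · x)) (a · ∂ ∅ (Q ∩ PI) x)
    ∂-sum      : ∀ B Q x y → Axiom (∂ B Q (x ⊕ y)) (∂ B Q x ⊕ ∂ B Q y)

  infix 4 _≃_
  data _≃_ : CTerm → CTerm → Set where
    refl   : ∀ {t} → t ≃ t
    sym    : ∀ {s t} → s ≃ t → t ≃ s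
    trans  : ∀ {s t u} → s ≃ t → t ≃ u → s ≃ u
    cong-· : ∀ a {s t} → s ≃ t → a · s ≃ a · t
    cong-⊕ : ∀ {s s' t t'} → s ≃ s' → t ≃ t' → s ⊕ t ≃ s' ⊕ t'
    cong-∂ : ∀ B Q {s t} → s ≃ t → ∂ B Q s ≃ ∂ B Q t
    axiom  : ∀ {s t} → Axiom s t → s ≃ t

  ⊢⇒≃ : ∀ {s t : CTerm} → E⊢ s ≈ t → s ≃ t
  ⊢⇒≃ refl = refl
  ⊢⇒≃ (sym p) = sym (⊢⇒≃ p)
  ⊢⇒≃ (trans p q) = trans (⊢⇒≃ p) (⊢⇒≃ q)
  ⊢⇒≃ (cong-· a p) = cong-· a (⊢⇒≃ p)
  ⊢⇒≃ (cong-⊕ p q) = cong-⊕ (⊢⇒≃ p) (⊢⇒≃ q)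
  ⊢⇒≃ (cong-∂ B Q p) = cong-∂ B Q (⊢⇒≃ p)
  ⊢⇒≃ (A-comm x y) = axiom (comm x y)
  ⊢⇒≃ (A-assoc x y z) = axiom (assoc x y z)
  ⊢⇒≃ (A-idem x) = axiom (idem x)
  ⊢⇒≃ (A-δ x) = axiom (δ-unit x)
  ⊢⇒≃ (A-pers P a x P∈PI a∈AP) = axiom (persist P a x P∈PI a∈AP)
  ⊢⇒≃ (D-δ B Q) = axiom (∂-δ B Q)
  ⊢⇒≃ (D-κ∈ B Q P P∈Q) = axiom (∂-κ∈ B Q P P∈Q)
  ⊢⇒≃ (D-κ∉ B Q P P∉Q) = axiom (∂-κ∉ B Q P P∉Q)
  ⊢⇒≃ (D-blk B Q a t L a∈B enum) =
    subst (λ u → ∂ B Q (a · u) ≃ sumκ L) (≡.sym (embed-id t))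
          (axiom (∂-blocked B Q a t L a∈B enum))
  ⊢⇒≃ (D-nblk B Q a x a∉B) = axiom (∂-enabled B Q a x a∉B)
  ⊢⇒≃ (D-pre Q a x) = axiom (∂-prefix Q a x)
  ⊢⇒≃ (D-+ B Q x y) = axiom (∂-sum B Q x y)

  axiom-step→ : ∀ {s t a s'} → Axiom s t → Step s a s' → Step t a s'
  axiom-step→ (comm x y) (sumˡ _ st) = sumʳ _ st
  axiom-step→ (comm x y) (sumʳ _ st) = sumˡ _ st
  axiom-step→ (assoc x y z) (sumˡ _ (sumˡ _ st)) = sumˡ _ st
  axiom-step→ (assoc x y z) (sumˡ _ (sumʳ _ st)) = sumʳ _ (sumˡ _ st)
  axiom-step→ (assoc x y z) (sumʳ _ st) = sumʳ _ (sumʳ _ st)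
  axiom-step→ (idem x) (sumˡ _ st) = st
  axiom-step→ (idem x) (sumʳ _ st) = st
  axiom-step→ (δ-unit x) (sumˡ _ st) = st
  axiom-step→ (δ-unit x) (sumʳ _ ())
  axiom-step→ (persist P a x _ _) st = sumˡ _ st
  axiom-step→ (∂-δ B Q) (enc _ _ _ ())
  axiom-step→ (∂-κ∈ B Q P _) (enc _ _ _ ())
  axiom-step→ (∂-κ∉ B Q P _) (enc _ _ _ ())
  axiom-step→ (∂-blocked B Q a t L a∈B _) (enc _ _ a∉B (pre _ _)) = ⊥-elim (a∉B a∈B)
  axiom-step→ (∂-enabled B Q a x _) (enc _ _ _ (pre _ _)) = enc ∅ Q ∉⊥ (pre a x)
  axiom-step→ (∂-prefix Q a x) (enc _ _ _ (pre _ _)) = pre a _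
  axiom-step→ (∂-sum B Q x y) (enc _ _ a∉B (sumˡ _ st)) = sumˡ _ (enc B Q a∉B st)
  axiom-step→ (∂-sum B Q x y) (enc _ _ a∉B (sumʳ _ st)) = sumʳ _ (enc B Q a∉B st)

  axiom-step← : ∀ {s t a t'} → Axiom s t → Step t a t' → Step s a t'
  axiom-step← (comm x y) (sumˡ _ st) = sumʳ _ st
  axiom-step← (comm x y) (sumʳ _ st) = sumˡ _ st
  axiom-step← (assoc x y z) (sumˡ _ st) = sumˡ _ (sumˡ _ st)
  axiom-step← (assoc x y z) (sumʳ _ (sumˡ _ st)) = sumˡ _ (sumʳ _ st)
  axiom-step← (assoc x y z) (sumʳ _ (sumʳ _ st)) = sumʳ _ st
  axiom-step← (idem x) st = sumˡ _ st
  axiom-step← (δ-unit x) st = sumˡ _ st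
  axiom-step← (persist P a x _ _) (sumˡ _ st) = st
  axiom-step← (persist P a x _ _) (sumʳ _ ())
  axiom-step← (∂-δ B Q) ()
  axiom-step← (∂-κ∈ B Q P _) ()
  axiom-step← (∂-κ∉ B Q P _) ()
  axiom-step← (∂-blocked B Q a t L _ _) st = ⊥-elim (sumκ-inert L st)
  axiom-step← (∂-enabled B Q a x a∉B) (enc _ _ _ (pre _ _)) = enc B Q a∉B (pre a x)
  axiom-step← (∂-prefix Q a x) (pre _ _) = enc ∅ Q ∉⊥ (pre a x)
  axiom-step← (∂-sum B Q x y) (sumˡ _ (enc _ _ a∉B st)) = enc B Q a∉B (sumˡ _ st)
  axiom-step← (∂-sum B Q x y) (sumʳ _ (enc _ _ a∉B st)) = enc B Q a∉B (sumʳ _ st)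

  axiom-holds→ : ∀ {s t P} → Axiom s t → Holds P s → Holds P t
  axiom-holds→ (comm x y) (sumˡ _ h) = sumʳ _ h
  axiom-holds→ (comm x y) (sumʳ _ h) = sumˡ _ h
  axiom-holds→ (assoc x y z) (sumˡ _ (sumˡ _ h)) = sumˡ _ h
  axiom-holds→ (assoc x y z) (sumˡ _ (sumʳ _ h)) = sumʳ _ (sumˡ _ h)
  axiom-holds→ (assoc x y z) (sumʳ _ h) = sumʳ _ (sumʳ _ h)
  axiom-holds→ (idem x) (sumˡ _ h) = h
  axiom-holds→ (idem x) (sumʳ _ h) = h
  axiom-holds→ (δ-unit x) (sumˡ _ h) = h
  axiom-holds→ (δ-unit x) (sumʳ _ ())
  axiom-holds→ (persist P a x _ _) h = sumˡ _ h
  axiom-holds→ (∂-δ B Q) (enc _ _ _ ())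
  axiom-holds→ (∂-κ∈ B Q P P∈Q) (enc _ _ P∉Q (kap _)) = ⊥-elim (P∉Q P∈Q)
  axiom-holds→ (∂-κ∉ B Q P _) (enc _ _ _ h) = h
  axiom-holds→ (∂-blocked B Q a t L _ enum) (enc _ _ P∉Q h) =
    ∈⇒sumκ-holds L (Equivalence.from (enum _) (P∉Q , h))
  axiom-holds→ (∂-enabled B Q a x _) (enc _ _ P∉Q h) = enc ∅ Q P∉Q h
  axiom-holds→ (∂-prefix Q a x) (enc _ _ P∉Q (pre _ P∈PI a∈AP h)) =
    pre a P∈PI a∈AP (enc ∅ (Q ∩ PI) (λ P∈Q∩PI → P∉Q (proj₁ (x∈p∩q⁻ Q PI P∈Q∩PI))) h)
  axiom-holds→ (∂-sum B Q x y) (enc _ _ P∉Q (sumˡ _ h)) = sumˡ _ (enc B Q P∉Q h)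
  axiom-holds→ (∂-sum B Q x y) (enc _ _ P∉Q (sumʳ _ h)) = sumʳ _ (enc B Q P∉Q h)

  axiom-holds← : ∀ {s t P} → Axiom s t → Holds P t → Holds P s
  axiom-holds← (comm x y) (sumˡ _ h) = sumʳ _ h
  axiom-holds← (comm x y) (sumʳ _ h) = sumˡ _ h
  axiom-holds← (assoc x y z) (sumˡ _ h) = sumˡ _ (sumˡ _ h)
  axiom-holds← (assoc x y z) (sumʳ _ (sumˡ _ h)) = sumˡ _ (sumʳ _ h)
  axiom-holds← (assoc x y z) (sumʳ _ (sumʳ _ h)) = sumʳ _ h
  axiom-holds← (idem x) h = sumˡ _ h
  axiom-holds← (δ-unit x) h = sumˡ _ h
  axiom-holds← (persist P a x _ _) (sumˡ _ h) = h
  axiom-holds← (persist P a x P∈PI a∈AP) (sumʳ _ (kap _)) = pre a P∈PI a∈AP (sumʳ x (kap P))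
  axiom-holds← (∂-δ B Q) ()
  axiom-holds← (∂-κ∈ B Q P _) ()
  axiom-holds← (∂-κ∉ B Q P P∉Q) (kap _) = enc B Q P∉Q (kap P)
  axiom-holds← (∂-blocked B Q a t L _ enum) h =
    let (P∉Q , h') = Equivalence.to (enum _) (sumκ-holds⇒∈ L h) in enc B Q P∉Q h'
  axiom-holds← (∂-enabled B Q a x _) (enc _ _ P∉Q h) = enc B Q P∉Q h
  axiom-holds← (∂-prefix Q a x) (pre _ P∈PI a∈AP (enc _ _ P∉Q∩PI h)) =
    enc ∅ Q (λ P∈Q → P∉Q∩PI (x∈p∩q⁺ (P∈Q , P∈PI))) (pre a P∈PI a∈AP h)
  axiom-holds← (∂-sum B Q x y) (sumˡ _ (enc _ _ P∉Q h)) = enc B Q P∉Q (sumˡ _ h)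
  axiom-holds← (∂-sum B Q x y) (sumʳ _ (enc _ _ P∉Q h)) = enc B Q P∉Q (sumʳ _ h)

  record Simulates (s t : CTerm) : Set where
    field
      step  : ∀ {a s'} → Step s a s' → ∃ λ t' → Step t a t' × s' ≃ t'
      holds : ∀ {P} → Holds P s → Holds P t
  open Simulates

  exact-simulation : ∀ {s t} → (∀ {a s'} → Step s a s' → Step t a s') →
                     (∀ {P} → Holds P s → Holds P t) → Simulates s t
  exact-simulation step→ holds→ =
    record { step = λ st → _ , step→ st , refl ; holds = holds→ }

  simulates-trans : ∀ {s t u} → Simulates s t → Simulates t u → Simulates s u
  step (simulates-trans S T) st with step S st
  ... | t' , st' , s'≃t' with step T st'
  ... | u' , su , t'≃u' = u' , su , trans s'≃t' t'≃u'
  holds (simulates-trans S T) h = holds T (holds S h)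

  simulates-· : ∀ a {s t} → s ≃ t → Simulates s t → Simulates (a · s) (a · t)
  step (simulates-· a s≃t S) (pre _ _) = _ , pre a _ , s≃t
  holds (simulates-· a s≃t S) (pre _ P∈PI a∈AP h) = pre a P∈PI a∈AP (holds S h)

  simulates-⊕ : ∀ {s s' t t'} → Simulates s s' → Simulates t t' →
                Simulates (s ⊕ t) (s' ⊕ t')
  step (simulates-⊕ S T) (sumˡ _ st) =
    let (u , su , e) = step S st in u , sumˡ _ su , e
  step (simulates-⊕ S T) (sumʳ _ st) =
    let (u , su , e) = step T st in u , sumʳ _ su , e
  holds (simulates-⊕ S T) (sumˡ _ h) = sumˡ _ (holds S h)
  holds (simulates-⊕ S T) (sumʳ _ h) = sumʳ _ (holds T h)

  simulates-∂ : ∀ B Q {s t} → Simulates s t → Simulates (∂ B Q s) (∂ B Q t)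
  step (simulates-∂ B Q S) (enc _ _ a∉B st) =
    let (u , su , e) = step S st in _ , enc B Q a∉B su , cong-∂ ∅ (Q ∩ PI) e
  holds (simulates-∂ B Q S) (enc _ _ P∉Q h) = enc B Q P∉Q (holds S h)

  ≃-simulates : ∀ {s t} → s ≃ t → Simulates s t × Simulates t s
  ≃-simulates refl = exact-simulation id id , exact-simulation id id
  ≃-simulates (sym p) = swap (≃-simulates p)
  ≃-simulates (trans p q) =
    let (P→ , P←) = ≃-simulates p ; (Q→ , Q←) = ≃-simulates q
    in simulates-trans P→ Q→ , simulates-trans Q← P←
  ≃-simulates (cong-· a p) =
    let (P→ , P←) = ≃-simulates p
    in simulates-· a p P→ , simulates-· a (sym p) P←
  ≃-simulates (cong-⊕ p q) =
    let (P→ , P←) = ≃-simulates p ; (Q→ , Q←) = ≃-simulates q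
    in simulates-⊕ P→ Q→ , simulates-⊕ P← Q←
  ≃-simulates (cong-∂ B Q p) =
    let (P→ , P←) = ≃-simulates p
    in simulates-∂ B Q P→ , simulates-∂ B Q P←
  ≃-simulates (axiom ax) =
    exact-simulation (axiom-step→ ax) (axiom-holds→ ax) ,
    exact-simulation (axiom-step← ax) (axiom-holds← ax)

  ≃-isBisimulation : IsBisimulation _≃_
  ≃-isBisimulation = record
    { symm   = sym
    ; transˡ = λ p → step (proj₁ (≃-simulates p))
    ; transʳ = λ p st →
        let (s' , ss , t'≃s') = step (proj₂ (≃-simulates p)) st in s' , ss , sym t'≃s'
    ; preds  = λ p P → mk⇔ (holds (proj₁ (≃-simulates p))) (holds (proj₂ (≃-simulates p)))
    }

  soundness : ∀ (s t : CTerm) → E⊢ s ≈ t → s ∼ t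
  soundness s t p = _≃_ , ≃-isBisimulation , ⊢⇒≃ p

  holds? : ∀ P t → Dec (Holds P t)
  holds? P (var ())
  holds? P δ = no λ ()
  holds? P (κ R) with P ≟ R
  ... | yes ≡.refl = yes (kap P)
  ... | no P≢R = no λ { (kap _) → P≢R ≡.refl }
  holds? P (a · t) with P ∈? PI | a ∈? AP P | holds? P t
  ... | yes P∈PI | yes a∈AP | yes h = yes (pre a P∈PI a∈AP h)
  ... | no P∉PI | _ | _ = no λ { (pre _ P∈PI _ _) → P∉PI P∈PI }
  ... | yes _ | no a∉AP | _ = no λ { (pre _ _ a∈AP _) → a∉AP a∈AP }
  ... | yes _ | yes _ | no ¬h = no λ { (pre _ _ _ h) → ¬h h }
  holds? P (t ⊕ u) with holds? P t | holds? P u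
  ... | yes h | _ = yes (sumˡ _ h)
  ... | no _ | yes h = yes (sumʳ _ h)
  ... | no ¬h₁ | no ¬h₂ = no λ { (sumˡ _ h) → ¬h₁ h ; (sumʳ _ h) → ¬h₂ h }
  holds? P (∂ B Q t) with P ∈? Q | holds? P t
  ... | yes P∈Q | _ = no λ { (enc _ _ P∉Q _) → P∉Q P∈Q }
  ... | no P∉Q | yes h = yes (enc B Q P∉Q h)
  ... | no _ | no ¬h = no λ { (enc _ _ _ h) → ¬h h }

  HasFreeForm : CTerm → Set₁
  HasFreeForm t = ∃ λ (t' : CTerm) → ∂Free t' × (E⊢ t ≈ t')

  blocked-free-form : ∀ B Q a (t : CTerm) → a ∈ B → HasFreeForm (∂ B Q (a · t))
  blocked-free-form B Q a t a∈B =
    let (L , enum) = enumerate (λ P → P ∉ Q × Holds P (a · t))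
                               (λ P → ¬? (P ∈? Q) ×-dec holds? P (a · t))
    in sumκ L , sumκ-∂Free L ,
       subst (λ u → E⊢ ∂ B Q (a · u) ≈ sumκ L) (embed-id t) (D-blk B Q a t L a∈B enum)

  encapsulation-free-form : ∀ B Q {u : CTerm} → ∂Free u → HasFreeForm (∂ B Q u)
  encapsulation-free-form B Q δ = δ , δ , D-δ B Q
  encapsulation-free-form B Q (κ P) with P ∈? Q
  ... | yes P∈Q = δ , δ , D-κ∈ B Q P P∈Q
  ... | no P∉Q = κ P , κ P , D-κ∉ B Q P P∉Q
  encapsulation-free-form B Q (f ⊕ g) =
    let (u , fu , eu) = encapsulation-free-form B Q f
        (v , fv , ev) = encapsulation-free-form B Q g
    in u ⊕ v , fu ⊕ fv , trans (D-+ B Q _ _) (cong-⊕ eu ev)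
  encapsulation-free-form B Q (_·_ a {u} f) with a ∈? B
  ... | yes a∈B = blocked-free-form B Q a u a∈B
  ... | no a∉B =
    let (v , fv , ev) = encapsulation-free-form ∅ (Q ∩ PI) f
    in a · v , a · fv , trans (D-nblk B Q a u a∉B) (trans (D-pre Q a u) (cong-· a ev))

  elimination : ∀ (t : CTerm) → HasFreeForm t
  elimination (var ())
  elimination δ = δ , δ , refl
  elimination (κ P) = κ P , κ P , refl
  elimination (a · t) =
    let (u , fu , eu) = elimination t in a · u , a · fu , cong-· a eu
  elimination (t ⊕ s) =
    let (u , fu , eu) = elimination t ; (v , fv , ev) = elimination s
    in u ⊕ v , fu ⊕ fv , cong-⊕ eu ev
  elimination (∂ B Q t) =
    let (u , fu , eu) = elimination t
        (v , fv , ev) = encapsulation-free-form B Q fu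
    in v , fv , trans (cong-∂ B Q eu) ev

theorem11 : (nA nP : ℕ) (PI : Subset nP) (AP : Fin nP → Subset (suc nA)) →
    let open FTP nA nP PI AP in
    (∀ (s t : CTerm) → E⊢ s ≈ t → s ∼ t) ×
    (∀ (t : CTerm) → ∃ λ (t' : CTerm) → ∂Free t' × (E⊢ t ≈ t'))
theorem11 nA nP PI AP = soundness nA nP PI AP , elimination nA nP PI AP
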